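{- Let $N>1$ be an integer and $p$ a prime. If every element of $S'_N$ is divisible by $p$ and $|S'_N|\ge 4$, then either $N=p^k$ for some $k\ge1$, or $N=p^kq$ for some $k\ge 1$ and some prime $q>p^k$.
   Context: $S'_N=\{d:1<d<\sqrt{N},\ d\mid N\}$. -}

module Defs where

open import Data.Nat using (ℕ; _<_; _*_; _<?_)
open import Data.Nat.Divisibility using (_∣_; _∣?_)
open import Data.List using (List; filter; upTo)
open import Data.Product using (_×_)
open import Relation.Nullary.Decidable using (_×-dec_)

-- The defining predicate of S'_N : 1 < d, d < sqrt N (i.e. d * d < N), d ∣ N.
InS' : ℕ → ℕ → Set
InS' N d = (1 < d) × (d * d < N) × (d ∣ N)

-- S'_N as the list of its elements in increasing order (no repetitions),
-- obtained by filtering 0,1,...,N-1 (every element of S'_N is < N).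
S' : ℕ → List ℕ
S' N = filter (λ d → (1 <? d) ×-dec ((d * d <? N) ×-dec (d ∣? N))) (upTo N)

-- Write N = p ^ k * m with p ∤ m; k ≥ 1 because p divides the elements of S'_N, which divide N.
-- A divisor d > 1 of m is prime to p, so it is not in S'_N, i.e. d * d ≥ N. If m = 1 we are
-- done. Otherwise m = e * d with d, e > 1 would give N * N ≤ (e * d) * (e * d) = m * m < N * N,
-- so m is prime; and d = m gives p ^ k * m = N ≤ m * m, so p ^ k ≤ m, with equality excluded
-- because p ∤ m.
module Submission where

open import Defs
open import Data.Nat using (ℕ; zero; suc; _<_; _≤_; _*_; _^_; z≤n; s≤s; z<s; _<?_)
open import Data.Nat.Base using (nonTrivial⇒n>1; n>1⇒nonTrivial; >-nonZero)
open import Data.Nat.Properties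
open import Data.Nat.Divisibility
  using (_∣_; _∤_; _∣?_; divides; ∣-trans; m∣m*n; quotient; quotient-∣; quotient>1; m∣n⇒n≡quotient*m)
open import Data.Nat.Induction using (<-wellFounded)
open import Data.Nat.Primality using (Prime; prime; Composite; composite; prime⇒nonTrivial)
open import Data.List using (length; upTo)
open import Data.List.Membership.Propositional using (_∈_)
open import Data.List.Membership.Propositional.Properties using (∈-filter⁺; ∈-filter⁻; ∈-upTo⁺)
open import Data.List.Relation.Unary.All using (All; _∷_)
import Data.List.Relation.Unary.All as All
open import Data.Product using (_×_; ∃-syntax; _,_; proj₂)
open import Data.Sum using (_⊎_; inj₁; inj₂)
open import Induction.WellFounded using (Acc; acc)
open import Relation.Nullary using (¬_; yes; no; contradiction)
open import Relation.Nullary.Decidable using (_×-dec_)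
open import Relation.Binary.PropositionalEquality using (_≡_; refl; sym; trans; cong; subst; module ≡-Reasoning)

∈-S'⁺ : ∀ {N d} → InS' N d → d ∈ S' N
∈-S'⁺ {N} {d} d∈S'@(1<d , d*d<N , _) = ∈-filter⁺ _ (∈-upTo⁺ d<N) d∈S'
  where
  instance _ = >-nonZero (<-trans z<s 1<d)
  d<N : d < N
  d<N = ≤-<-trans (m≤m*n d d) d*d<N

∈-S'⁻ : ∀ {N d} → d ∈ S' N → InS' N d
∈-S'⁻ {N} d∈ = proj₂ (∈-filter⁻ (λ d → (1 <? d) ×-dec ((d * d <? N) ×-dec (d ∣? N))) {xs = upTo N} d∈)

S'-∣ : ∀ N → All (_∣ N) (S' N)
S'-∣ N = All.tabulate (λ d∈ → proj₂ (proj₂ (∈-S'⁻ d∈)))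

∣-trans-head : ∀ {p N xs} → All (p ∣_) xs → All (_∣ N) xs → 0 < length xs → p ∣ N
∣-trans-head (p∣d ∷ _) (d∣N ∷ _) _ = ∣-trans p∣d d∣N

p-free-part : ∀ {p} → 1 < p → ∀ n → 0 < n → ∃[ a ] ∃[ m ] (n ≡ p ^ a * m × p ∤ m)
p-free-part {p} 1<p n = go n (<-wellFounded n)
  where
  open ≡-Reasoning
  go : ∀ n → Acc _<_ n → 0 < n → ∃[ a ] ∃[ m ] (n ≡ p ^ a * m × p ∤ m)
  go n _ _ with p ∣? n
  go n _ _ | no p∤n = 0 , n , sym (*-identityˡ n) , p∤n
  go n _ 0<n | yes (divides zero refl) = contradiction 0<n (<-irrefl refl)
  go n (acc rec) _ | yes (divides q@(suc _) n≡q*p)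
    with go q (rec (subst (q <_) (sym n≡q*p) (m<m*n q p 1<p))) z<s
  ... | a , m , q≡pᵃ*m , p∤m = suc a , m , n≡pᵃ⁺¹*m , p∤m
    where
    n≡pᵃ⁺¹*m : n ≡ p ^ suc a * m
    n≡pᵃ⁺¹*m = begin
      n               ≡⟨ n≡q*p ⟩
      q * p           ≡⟨ cong (_* p) q≡pᵃ*m ⟩
      p ^ a * m * p   ≡⟨ *-comm (p ^ a * m) p ⟩
      p * (p ^ a * m) ≡⟨ *-assoc p (p ^ a) m ⟨
      p * p ^ a * m   ∎

nonTrivialDivisors-square≥⇒prime : ∀ {m N} → 1 < m → m < N →
  (∀ {d} → 1 < d → d ∣ m → N ≤ d * d) → Prime m
nonTrivialDivisors-square≥⇒prime {m} {N} 1<m m<N square≥ = prime ¬composite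
  where
  instance _ = n>1⇒nonTrivial 1<m
  ¬composite : ¬ Composite m
  ¬composite (composite {d} d<m d∣m) = <⇒≱ (*-mono-< m<N m<N) (begin
    N * N             ≤⟨ *-mono-≤ (square≥ (quotient>1 d∣m d<m) (quotient-∣ d∣m))
                                  (square≥ (nonTrivial⇒n>1 d) d∣m) ⟩
    (e * e) * (d * d) ≡⟨ [m*n]*[o*p]≡[m*o]*[n*p] e e d d ⟩
    (e * d) * (e * d) ≡⟨ cong (λ x → x * x) (m∣n⇒n≡quotient*m d∣m) ⟨
    m * m             ∎)
    where
    open ≤-Reasoning
    e = quotient d∣m

module _ {N p : ℕ} (p∣InS' : ∀ {d} → InS' N d → p ∣ d) where

  p∤d⇒N≤d*d : ∀ {d} → 1 < d → d ∣ N → p ∤ d → N ≤ d * d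
  p∤d⇒N≤d*d 1<d d∣N p∤d = ≮⇒≥ (λ d*d<N → p∤d (p∣InS' (1<d , d*d<N , d∣N)))

  p-free-part-prime∧> : ∀ {a m} → 1 < p → N ≡ p ^ suc a * m → p ∤ m → 1 < m →
    Prime m × p ^ suc a < m
  p-free-part-prime∧> {a} {m} 1<p N≡pᵏ*m p∤m 1<m = m-prime , pᵏ<m
    where
    pᵏ = p ^ suc a
    instance
      _ = >-nonZero (<-trans z<s 1<m)
      _ = >-nonZero (<-trans z<s 1<p)
    m∣N : m ∣ N
    m∣N = divides pᵏ N≡pᵏ*m
    square≥ : ∀ {d} → 1 < d → d ∣ m → N ≤ d * d
    square≥ 1<d d∣m = p∤d⇒N≤d*d 1<d (∣-trans d∣m m∣N) (λ p∣d → p∤m (∣-trans p∣d d∣m))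
    m<N : m < N
    m<N = subst (m <_) (trans (*-comm m pᵏ) (sym N≡pᵏ*m))
                (m<m*n m pᵏ (*-mono-≤ 1<p (m^n>0 p a)))
    m-prime : Prime m
    m-prime = nonTrivialDivisors-square≥⇒prime 1<m m<N square≥
    pᵏ<m : pᵏ < m
    pᵏ<m = ≤∧≢⇒< (*-cancelʳ-≤ pᵏ m m (subst (_≤ m * m) N≡pᵏ*m N≤m*m))
                 (λ pᵏ≡m → p∤m (subst (p ∣_) pᵏ≡m (m∣m*n (p ^ a))))
      where
      N≤m*m : N ≤ m * m
      N≤m*m = square≥ 1<m (divides 1 (sym (*-identityˡ m)))

proposition2p2 : (N p : ℕ) → 1 < N → Prime p →
    All (λ d → p ∣ d) (S' N) → 4 ≤ length (S' N) →
    (∃[ k ] (1 ≤ k × N ≡ p ^ k))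
    ⊎ (∃[ k ] ∃[ q ] (1 ≤ k × Prime q × p ^ k < q × N ≡ p ^ k * q))
proposition2p2 N p 1<N p-prime p∣S' 4≤|S'| = classify (p-free-part 1<p N (<-trans z<s 1<N))
  where
  instance _ = prime⇒nonTrivial p-prime
  1<p : 1 < p
  1<p = nonTrivial⇒n>1 p
  p∣N : p ∣ N
  p∣N = ∣-trans-head p∣S' (S'-∣ N) (<-≤-trans z<s 4≤|S'|)
  classify : ∃[ a ] ∃[ m ] (N ≡ p ^ a * m × p ∤ m) →
    (∃[ k ] (1 ≤ k × N ≡ p ^ k)) ⊎ (∃[ k ] ∃[ q ] (1 ≤ k × Prime q × p ^ k < q × N ≡ p ^ k * q))
  classify (a , zero , N≡pᵃ*0 , _) = contradiction (trans N≡pᵃ*0 (*-zeroʳ (p ^ a))) (>⇒≢ (<-trans z<s 1<N))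
  classify (zero , m , N≡1*m , p∤m) = contradiction (subst (p ∣_) (trans N≡1*m (*-identityˡ m)) p∣N) p∤m
  classify (suc a , 1 , N≡pᵏ*1 , _) = inj₁ (suc a , s≤s z≤n , trans N≡pᵏ*1 (*-identityʳ _))
  classify (suc a , m@(suc (suc _)) , N≡pᵏ*m , p∤m) =
    let m-prime , pᵏ<m = p-free-part-prime∧> (λ d∈ → All.lookup p∣S' (∈-S'⁺ d∈))
                                             {a} 1<p N≡pᵏ*m p∤m (s≤s (s≤s z≤n))
    in inj₂ (suc a , m , s≤s z≤n , m-prime , pᵏ<m , N≡pᵏ*m)
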